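{- Let $b_{n,m}$ denote the number of Deutsch paths of length $n$ from $(0,0)$ to $(n,0)$ having exactly $m$ maximal runs of up-steps of length $1$. Then \[ \sum_{n,m\ge0} b_{n,m} z^n t^m=\frac{1+z+z^2-tz^2-\sqrt{t^2z^4+2tz^3-2tz^2+2tz^4-z^2-2z-2z^3+1-3z^4}}{2z(1+z)(1+z^2-tz^2)} \] \[ =1+tz^2+z^3+(t^2+2)z^4+(3+3t)z^5+(7+7t+t^3)z^6+(17+13t+6t^2)z^7+\cdots. \]
   Context: A Deutsch path is a lattice path starting at $(0,0)$ that uses up-steps $(1,1)$ and down-steps $(1,-j)$ for any integer $j\ge1$, and never goes below the $x$-axis; its length is its number of steps. A maximal run of up-steps is a maximal sequence of consecutive up-steps; its length is its number of steps. The empty path (length $0$) is counted. The square root denotes the branch that is a formal power series in $z$ with constant term $1$. -}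

module Defs where

open import Data.Nat using (ℕ; zero; suc; _+_; _∸_; _≤ᵇ_; _≡ᵇ_)
open import Data.Bool using (Bool; true; false; _∧_; if_then_else_)
open import Data.List using (List; []; _∷_; _++_; length; map; concatMap; filterᵇ; upTo)
open import Data.Maybe using (Maybe; just; nothing)
open import Data.Integer as ℤ using (ℤ; +_)
open import Relation.Binary.PropositionalEquality using (_≡_)

-- A step: U is the up-step (1,1); D k is the down-step (1,-(k+1)),
-- so D k ranges over all down-steps (1,-j) with j ≥ 1.
data Step : Set where
  U : Step
  D : ℕ → Step

walk : ℕ → List Step → Maybe ℕ
walk h []          = just h
walk h (U ∷ s)     = walk (suc h) s
walk h (D k ∷ s)   = if suc k ≤ᵇ h then walk (h ∸ suc k) s else nothing

endsAtZero : List Step → Bool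
endsAtZero s with walk 0 s
... | just zero = true
... | _         = false

-- Lengths of the maximal runs of up-steps (acc = length of current run).
upRunsFrom : ℕ → List Step → List ℕ
upRunsFrom zero    []        = []
upRunsFrom (suc a) []        = suc a ∷ []
upRunsFrom a       (U ∷ s)   = upRunsFrom (suc a) s
upRunsFrom zero    (D k ∷ s) = upRunsFrom zero s
upRunsFrom (suc a) (D k ∷ s) = suc a ∷ upRunsFrom zero s

upRuns : List Step → List ℕ
upRuns = upRunsFrom zero

runs1 : List Step → ℕ
runs1 s = length (filterᵇ (λ r → r ≡ᵇ 1) (upRuns s))

-- All step sequences of length l whose down-steps have size ≤ bd.
-- (A Deutsch path of length n never has a down-step of size > n,
--  so taking bd = n enumerates all candidates.)
seqs : ℕ → ℕ → List (List Step)
seqs bd zero    = [] ∷ []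
seqs bd (suc l) = concatMap (λ s → map (λ st → st ∷ s) (U ∷ map D (upTo bd))) (seqs bd l)

b : ℕ → ℕ → ℕ
b n m = length (filterᵇ (λ s → endsAtZero s ∧ (runs1 s ≡ᵇ m)) (seqs n n))

-- Formal power series in z, t over ℤ: F i j = coefficient of z^i t^j.

FPS : Set
FPS = ℕ → ℕ → ℤ

_≋_ : FPS → FPS → Set
F ≋ G = ∀ i j → F i j ≡ G i j
infix 4 _≋_

sumTo : ℕ → (ℕ → ℤ) → ℤ
sumTo zero    f = f zero
sumTo (suc n) f = sumTo n f ℤ.+ f (suc n)

_⊕_ : FPS → FPS → FPS
(F ⊕ G) i j = F i j ℤ.+ G i j

_⊖_ : FPS → FPS → FPS
(F ⊖ G) i j = F i j ℤ.- G i j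

_⊗_ : FPS → FPS → FPS
(F ⊗ G) i j = sumTo i (λ a → sumTo j (λ c → F a c ℤ.* G (i ∸ a) (j ∸ c)))

infixl 6 _⊕_ _⊖_
infixl 7 _⊗_

mon : ℤ → ℕ → ℕ → FPS
mon c a e i j = if (i ≡ᵇ a) ∧ (j ≡ᵇ e) then c else + 0

Bser : FPS
Bser n m = + b n m

Rad : FPS
Rad = mon (+ 1) 4 2 ⊕ mon (+ 2) 3 1 ⊖ mon (+ 2) 2 1 ⊕ mon (+ 2) 4 1
      ⊖ mon (+ 1) 2 0 ⊖ mon (+ 2) 1 0 ⊖ mon (+ 2) 3 0 ⊕ mon (+ 1) 0 0
      ⊖ mon (+ 3) 4 0

Num : FPS
Num = mon (+ 1) 0 0 ⊕ mon (+ 1) 1 0 ⊕ mon (+ 1) 2 0 ⊖ mon (+ 1) 2 1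

Den : FPS
Den = mon (+ 2) 1 0 ⊗ (mon (+ 1) 0 0 ⊕ mon (+ 1) 1 0)
      ⊗ (mon (+ 1) 0 0 ⊕ mon (+ 1) 2 0 ⊖ mon (+ 1) 2 1)

zConstOne : FPS → Set
zConstOne S = ∀ j → S 0 j ≡ (if j ≡ᵇ 0 then + 1 else + 0)

table : ℕ → ℕ → ℕ
table 0 0 = 1
table 2 1 = 1
table 3 0 = 1
table 4 0 = 2
table 4 2 = 1
table 5 0 = 3
table 5 1 = 3
table 6 0 = 7
table 6 1 = 7
table 6 3 = 1
table 7 0 = 17
table 7 1 = 13
table 7 2 = 6
table _ _ = 0

module Submission where

-- A step sequence is read left to right from state (h, a): the
-- current height h and the length a of the current up-run.  The number
-- paths a h l m of continuations of length l that end on the x-axis with m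
-- up-runs of length 1 satisfies a first-step recurrence, and
-- b n m = paths 0 0 n m (b≡paths); the table for n ≤ 7 is evaluation.
--
-- Power series over a commutative ring form a
-- commutative ring (PowerSeries); iterating gives ℤ[[t]][[z]], whose
-- product is the ⊗ of the statement.  For G a h = Σ paths a h l m z^l t^m
-- the recurrence reads G a h = [h = 0]·w_a + z (G (a+1) (h+1) + w_a·Dsum h),
-- where w_1 = t, w_a = 1 otherwise, and Dsum h = Σ_{j<h} G 0 j.  By
-- induction on the z-order, G a (h+2) = X·G a (h+1) with X = (1+z)·B,
-- B = G 0 0.  This closes the system B = 1 + z C₁, C₁ = z (X C₂ + t B),
-- C₂ = z (X C₂ + B), and a polynomial identity (checked by the ring solver)
-- shows that S = Num − Den·B squares to Rad modulo these relations.

open import Defs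
open import Data.Nat using (ℕ; _≤_)
open import Data.Product using (Σ; _×_)
open import Relation.Binary.PropositionalEquality using (_≡_)
open import Algebra.Bundles using (CommutativeRing)

-- They form a commutative ring again; this
-- is used twice, to build ℤ[[t]] and then ℤ[[t]][[z]].
module PowerSeries {c ℓ} (R : CommutativeRing c ℓ) where
  open import Algebra.Structures using (IsCommutativeRing)
  open import Data.Nat using (ℕ; zero; suc; _∸_; _≤_; z≤n)
  import Data.Nat as ℕ
  open import Data.Nat.Properties
    using (n∸n≡0; +-∸-assoc; ≤-refl; m≤n⇒m≤1+n; ∸-+-assoc; m+[n∸m]≡n; m∸[m∸n]≡n)
  open import Data.Product using (_,_)
  import Algebra.Construct.Pointwise as Pointwise
  import Relation.Binary.PropositionalEquality as P
  open CommutativeRing R hiding (zero)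
  open import Algebra.Properties.CommutativeSemigroup +-commutativeSemigroup using (interchange)
  open import Relation.Binary.Reasoning.Setoid setoid

  Σ≤ : ℕ → (ℕ → Carrier) → Carrier
  Σ≤ zero    f = f zero
  Σ≤ (suc n) f = Σ≤ n f + f (suc n)

  Σ-cong : ∀ n {f g : ℕ → Carrier} → (∀ a → a ≤ n → f a ≈ g a) → Σ≤ n f ≈ Σ≤ n g
  Σ-cong zero    f≈g = f≈g 0 z≤n
  Σ-cong (suc n) f≈g = +-cong (Σ-cong n (λ a a≤n → f≈g a (m≤n⇒m≤1+n a≤n))) (f≈g (suc n) ≤-refl)

  Σ-cong′ : ∀ n {f g : ℕ → Carrier} → (∀ a → f a ≈ g a) → Σ≤ n f ≈ Σ≤ n g
  Σ-cong′ n f≈g = Σ-cong n (λ a _ → f≈g a)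

  Σ-+ : ∀ n (f g : ℕ → Carrier) → Σ≤ n (λ a → f a + g a) ≈ Σ≤ n f + Σ≤ n g
  Σ-+ zero    f g = refl
  Σ-+ (suc n) f g = trans (+-congʳ (Σ-+ n f g)) (interchange _ _ _ _)

  Σ-*ˡ : ∀ n x (f : ℕ → Carrier) → x * Σ≤ n f ≈ Σ≤ n (λ a → x * f a)
  Σ-*ˡ zero    x f = refl
  Σ-*ˡ (suc n) x f = trans (distribˡ x _ _) (+-congʳ (Σ-*ˡ n x f))

  Σ-*ʳ : ∀ n x (f : ℕ → Carrier) → Σ≤ n f * x ≈ Σ≤ n (λ a → f a * x)
  Σ-*ʳ n x f = trans (*-comm _ x) (trans (Σ-*ˡ n x f) (Σ-cong′ n (λ a → *-comm x (f a))))

  Σ-0 : ∀ n → Σ≤ n (λ _ → 0#) ≈ 0#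
  Σ-0 zero    = refl
  Σ-0 (suc n) = trans (+-identityʳ _) (Σ-0 n)

  Σ-shift : ∀ n (f : ℕ → Carrier) → Σ≤ (suc n) f ≈ f 0 + Σ≤ n (λ a → f (suc a))
  Σ-shift zero    f = refl
  Σ-shift (suc n) f = trans (+-congʳ (Σ-shift n f)) (+-assoc _ _ _)

  Σ-reverse : ∀ n (f : ℕ → Carrier) → Σ≤ n f ≈ Σ≤ n (λ a → f (n ∸ a))
  Σ-reverse zero    f = refl
  Σ-reverse (suc n) f = begin
    Σ≤ n f + f (suc n)                 ≈⟨ +-comm _ _ ⟩
    f (suc n) + Σ≤ n f                 ≈⟨ +-congˡ (Σ-reverse n f) ⟩
    f (suc n) + Σ≤ n (λ a → f (n ∸ a)) ≈⟨ sym (Σ-shift n (λ a → f (suc n ∸ a))) ⟩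
    Σ≤ (suc n) (λ a → f (suc n ∸ a))   ∎

  Σ-triangle : ∀ n (F : ℕ → ℕ → Carrier) →
               Σ≤ n (λ a → Σ≤ a (λ b → F b (a ∸ b))) ≈ Σ≤ n (λ b → Σ≤ (n ∸ b) (F b))
  Σ-triangle zero    F = refl
  Σ-triangle (suc n) F = begin
    Σ≤ n (λ a → Σ≤ a (λ b → F b (a ∸ b))) + Σ≤ (suc n) (λ b → F b (suc n ∸ b))
      ≈⟨ +-congʳ (Σ-triangle n F) ⟩
    Σ≤ n (λ b → Σ≤ (n ∸ b) (F b)) + (Σ≤ n (λ b → F b (suc n ∸ b)) + F (suc n) (n ∸ n))
      ≈⟨ sym (+-assoc _ _ _) ⟩
    (Σ≤ n (λ b → Σ≤ (n ∸ b) (F b)) + Σ≤ n (λ b → F b (suc n ∸ b))) + F (suc n) (n ∸ n)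
      ≈⟨ +-congʳ (sym (Σ-+ n _ _)) ⟩
    Σ≤ n (λ b → Σ≤ (n ∸ b) (F b) + F b (suc n ∸ b)) + F (suc n) (n ∸ n)
      ≈⟨ +-cong (Σ-cong n (λ b b≤n → reflexive (extend b b≤n)))
                (reflexive (P.cong (F (suc n)) (n∸n≡0 n))) ⟩
    Σ≤ n (λ b → Σ≤ (suc n ∸ b) (F b)) + Σ≤ 0 (F (suc n))
      ≡⟨ P.cong (λ k → Σ≤ n (λ b → Σ≤ (suc n ∸ b) (F b)) + Σ≤ k (F (suc n))) (P.sym (n∸n≡0 n)) ⟩
    Σ≤ n (λ b → Σ≤ (suc n ∸ b) (F b)) + Σ≤ (suc n ∸ suc n) (F (suc n)) ∎
    where
    extend : ∀ b → b ≤ n → Σ≤ (n ∸ b) (F b) + F b (suc n ∸ b) P.≡ Σ≤ (suc n ∸ b) (F b)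
    extend b b≤n rewrite +-∸-assoc 1 b≤n = P.refl

  Series : Set c
  Series = ℕ → Carrier

  infix  4 _≐_
  infixl 6 _⊞_
  infixl 7 _⊠_

  _≐_ : Series → Series → Set ℓ
  f ≐ g = ∀ n → f n ≈ g n

  _⊞_ : Series → Series → Series
  (f ⊞ g) n = f n + g n

  _⊠_ : Series → Series → Series
  (f ⊠ g) n = Σ≤ n (λ a → f a * g (n ∸ a))

  const : Carrier → Series
  const x zero    = x
  const x (suc n) = 0#

  𝟙 𝟘 : Series
  𝟙 = const 1#
  𝟘 = λ _ → 0#

  𝕏 : Series
  𝕏 zero    = 0#
  𝕏 (suc n) = 𝟙 n

  ⊠-cong : ∀ {f f′ g g′} → f ≐ f′ → g ≐ g′ → f ⊠ g ≐ f′ ⊠ g′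
  ⊠-cong f≐f′ g≐g′ n = Σ-cong′ n (λ a → *-cong (f≐f′ a) (g≐g′ (n ∸ a)))

  ⊠-comm : ∀ f g → f ⊠ g ≐ g ⊠ f
  ⊠-comm f g n = trans (Σ-reverse n _) (Σ-cong n (λ a a≤n →
    trans (*-comm _ _) (*-congʳ (reflexive (P.cong g (m∸[m∸n]≡n a≤n))))))

  ⊠-assoc : ∀ f g h → (f ⊠ g) ⊠ h ≐ f ⊠ (g ⊠ h)
  ⊠-assoc f g h n = begin
    Σ≤ n (λ a → Σ≤ a (λ b → f b * g (a ∸ b)) * h (n ∸ a))
      ≈⟨ Σ-cong′ n (λ a → Σ-*ʳ a _ _) ⟩
    Σ≤ n (λ a → Σ≤ a (λ b → (f b * g (a ∸ b)) * h (n ∸ a)))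
      ≈⟨ Σ-cong′ n (λ a → Σ-cong a (λ b b≤a → trans (*-assoc _ _ _)
           (*-congˡ (*-congˡ (reflexive (P.cong (λ k → h (n ∸ k)) (P.sym (m+[n∸m]≡n b≤a)))))))) ⟩
    Σ≤ n (λ a → Σ≤ a (λ b → F b (a ∸ b)))
      ≈⟨ Σ-triangle n F ⟩
    Σ≤ n (λ b → Σ≤ (n ∸ b) (F b))
      ≈⟨ Σ-cong′ n (λ b → trans
           (Σ-cong′ (n ∸ b) (λ c → *-congˡ (*-congˡ (reflexive (P.cong h (P.sym (∸-+-assoc n b c)))))))
           (sym (Σ-*ˡ (n ∸ b) (f b) _))) ⟩
    Σ≤ n (λ b → f b * Σ≤ (n ∸ b) (λ c → g c * h ((n ∸ b) ∸ c))) ∎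
    where
    F : ℕ → ℕ → Carrier
    F b c = f b * (g c * h (n ∸ (b ℕ.+ c)))

  ⊠-distribˡ : ∀ f g h → f ⊠ (g ⊞ h) ≐ f ⊠ g ⊞ f ⊠ h
  ⊠-distribˡ f g h n = trans (Σ-cong′ n (λ a → distribˡ _ _ _)) (Σ-+ n _ _)

  ⊠-distribʳ : ∀ f g h → (g ⊞ h) ⊠ f ≐ g ⊠ f ⊞ h ⊠ f
  ⊠-distribʳ f g h n = trans (Σ-cong′ n (λ a → distribʳ _ _ _)) (Σ-+ n _ _)

  𝟘-⊠ : ∀ f → 𝟘 ⊠ f ≐ 𝟘
  𝟘-⊠ f n = trans (Σ-cong′ n (λ a → zeroˡ _)) (Σ-0 n)

  ⊠-suc : ∀ f g n → (f ⊠ g) (suc n) ≈ f 0 * g (suc n) + ((λ a → f (suc a)) ⊠ g) n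
  ⊠-suc f g n = Σ-shift n _

  const-⊠ : ∀ x f n → (const x ⊠ f) n ≈ x * f n
  const-⊠ x f zero    = refl
  const-⊠ x f (suc n) = begin
    (const x ⊠ f) (suc n)     ≈⟨ ⊠-suc (const x) f n ⟩
    x * f (suc n) + (𝟘 ⊠ f) n ≈⟨ +-congˡ (𝟘-⊠ f n) ⟩
    x * f (suc n) + 0#        ≈⟨ +-identityʳ _ ⟩
    x * f (suc n)             ∎

  ⊠-identityˡ : ∀ f → 𝟙 ⊠ f ≐ f
  ⊠-identityˡ f n = trans (const-⊠ 1# f n) (*-identityˡ (f n))

  𝕏-⊠-zero : ∀ f → (𝕏 ⊠ f) 0 ≈ 0#
  𝕏-⊠-zero f = zeroˡ _

  𝕏-⊠-suc : ∀ f n → (𝕏 ⊠ f) (suc n) ≈ f n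
  𝕏-⊠-suc f n = begin
    (𝕏 ⊠ f) (suc n)           ≈⟨ ⊠-suc 𝕏 f n ⟩
    0# * f (suc n) + (𝟙 ⊠ f) n ≈⟨ +-cong (zeroˡ _) (⊠-identityˡ f n) ⟩
    0# + f n                  ≈⟨ +-identityˡ _ ⟩
    f n                       ∎

  ⊞⊠-isCommutativeRing : IsCommutativeRing _≐_ _⊞_ _⊠_ (λ f n → - f n) 𝟘 𝟙
  ⊞⊠-isCommutativeRing = record
    { isRing = record
      { +-isAbelianGroup = Pointwise.isAbelianGroup ℕ +-isAbelianGroup
      ; *-cong           = ⊠-cong
      ; *-assoc          = ⊠-assoc
      ; *-identity       = ⊠-identityˡ , λ f n → trans (⊠-comm f 𝟙 n) (⊠-identityˡ f n)
      ; distrib          = ⊠-distribˡ , ⊠-distribʳ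
      }
    ; *-comm = ⊠-comm
    }

  seriesRing : CommutativeRing c ℓ
  seriesRing = record { isCommutativeRing = ⊞⊠-isCommutativeRing }

module Counting where

  open import Data.Nat using (ℕ; zero; suc; _+_; _∸_; _≤_; _<_; _≤ᵇ_; _≡ᵇ_; s≤s)
  open import Data.Nat.Properties
    using (+-assoc; +-suc; +-commutativeSemigroup; ≤-trans; ≤-refl; +-monoˡ-≤; +-monoʳ-≤; n≤1+n; m≤m+n; <⇒≤; m≤n⇒m≤1+n)
  open import Data.Bool using (Bool; true; false; _∧_; if_then_else_)
  open import Data.Bool.Properties using (∧-zeroʳ)
  open import Data.List using (List; []; _∷_; _++_; length; map; concatMap; filterᵇ; upTo; applyUpTo)
  open import Data.Maybe using (Maybe; just; nothing)
  open import Algebra.Properties.CommutativeSemigroup +-commutativeSemigroup using (interchange)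
  open import Relation.Binary.PropositionalEquality
  open ≡-Reasoning

  indicator : Bool → ℕ
  indicator true  = 1
  indicator false = 0

  sumOver : {A : Set} → List A → (A → ℕ) → ℕ
  sumOver []       f = 0
  sumOver (x ∷ xs) f = f x + sumOver xs f

  sumBelow : ℕ → (ℕ → ℕ) → ℕ
  sumBelow zero    f = 0
  sumBelow (suc n) f = f 0 + sumBelow n (λ k → f (suc k))

  -- Σ_{j < h} f j, last term first: the sum over the heights j reachable
  -- by one down-step from height h
  sumLess : ℕ → (ℕ → ℕ) → ℕ
  sumLess zero    f = 0
  sumLess (suc h) f = f h + sumLess h f

  length-filter : {A : Set} (p : A → Bool) (xs : List A) →
                  length (filterᵇ p xs) ≡ sumOver xs (λ x → indicator (p x))
  length-filter p []       = refl
  length-filter p (x ∷ xs) with p x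
  ... | true  = cong suc (length-filter p xs)
  ... | false = length-filter p xs

  sumOver-cong : {A : Set} (xs : List A) {f g : A → ℕ} → (∀ x → f x ≡ g x) → sumOver xs f ≡ sumOver xs g
  sumOver-cong []       f≡g = refl
  sumOver-cong (x ∷ xs) f≡g = cong₂ _+_ (f≡g x) (sumOver-cong xs f≡g)

  sumOver-zero : {A : Set} (xs : List A) {f : A → ℕ} → (∀ x → f x ≡ 0) → sumOver xs f ≡ 0
  sumOver-zero []       f≡0 = refl
  sumOver-zero (x ∷ xs) f≡0 = cong₂ _+_ (f≡0 x) (sumOver-zero xs f≡0)

  sumOver-++ : {A : Set} (xs ys : List A) (f : A → ℕ) → sumOver (xs ++ ys) f ≡ sumOver xs f + sumOver ys f
  sumOver-++ []       ys f = refl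
  sumOver-++ (x ∷ xs) ys f = trans (cong (f x +_) (sumOver-++ xs ys f)) (sym (+-assoc (f x) _ _))

  sumOver-concatMap : {A B : Set} (g : A → List B) (xs : List A) (f : B → ℕ) →
                      sumOver (concatMap g xs) f ≡ sumOver xs (λ x → sumOver (g x) f)
  sumOver-concatMap g []       f = refl
  sumOver-concatMap g (x ∷ xs) f =
    trans (sumOver-++ (g x) (concatMap g xs) f) (cong (sumOver (g x) f +_) (sumOver-concatMap g xs f))

  sumOver-map : {A B : Set} (g : A → B) (xs : List A) (f : B → ℕ) → sumOver (map g xs) f ≡ sumOver xs (λ x → f (g x))
  sumOver-map g []       f = refl
  sumOver-map g (x ∷ xs) f = cong (f (g x) +_) (sumOver-map g xs f)

  sumOver-applyUpTo : (g : ℕ → ℕ) (n : ℕ) (f : ℕ → ℕ) → sumOver (applyUpTo g n) f ≡ sumBelow n (λ k → f (g k))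
  sumOver-applyUpTo g zero    f = refl
  sumOver-applyUpTo g (suc n) f = cong (f (g 0) +_) (sumOver-applyUpTo (λ k → g (suc k)) n f)

  sumOver-+ : {A : Set} (xs : List A) (f g : A → ℕ) → sumOver xs (λ x → f x + g x) ≡ sumOver xs f + sumOver xs g
  sumOver-+ []       f g = refl
  sumOver-+ (x ∷ xs) f g = trans (cong ((f x + g x) +_) (sumOver-+ xs f g)) (interchange (f x) (g x) _ _)

  sumOver-sumBelow : {A : Set} (xs : List A) (n : ℕ) (f : A → ℕ → ℕ) →
                     sumOver xs (λ x → sumBelow n (f x)) ≡ sumBelow n (λ k → sumOver xs (λ x → f x k))
  sumOver-sumBelow xs zero    f = sumOver-zero xs (λ _ → refl)
  sumOver-sumBelow xs (suc n) f =
    trans (sumOver-+ xs _ _) (cong (sumOver xs (λ x → f x 0) +_) (sumOver-sumBelow xs n (λ x k → f x (suc k))))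

  sumBelow-cong : ∀ n {f g : ℕ → ℕ} → (∀ k → f k ≡ g k) → sumBelow n f ≡ sumBelow n g
  sumBelow-cong zero    f≡g = refl
  sumBelow-cong (suc n) f≡g = cong₂ _+_ (f≡g 0) (sumBelow-cong n (λ k → f≡g (suc k)))

  sumBelow-truncate : ∀ n h (f : ℕ → ℕ) → h ≤ n →
                      sumBelow n (λ k → if suc k ≤ᵇ h then f k else 0) ≡ sumBelow h f
  sumBelow-truncate n       zero    f _         = sumBelow-zero n
    where
    sumBelow-zero : ∀ n → sumBelow n (λ _ → 0) ≡ 0
    sumBelow-zero zero    = refl
    sumBelow-zero (suc n) = sumBelow-zero n
  sumBelow-truncate (suc n) (suc h) f (s≤s h≤n) = cong (f 0 +_) (sumBelow-truncate n h (λ k → f (suc k)) h≤n)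

  -- A down-step of size k + 1 from height h lands at height h − k − 1.
  sumBelow-targets : ∀ h (f : ℕ → ℕ) → sumBelow h (λ k → f (h ∸ suc k)) ≡ sumLess h f
  sumBelow-targets zero    f = refl
  sumBelow-targets (suc h) f = cong (f h +_) (sumBelow-targets h f)

  sumLess-cong : ∀ h {f g : ℕ → ℕ} → (∀ j → j < h → f j ≡ g j) → sumLess h f ≡ sumLess h g
  sumLess-cong zero    f≡g = refl
  sumLess-cong (suc h) f≡g = cong₂ _+_ (f≡g h ≤-refl) (sumLess-cong h (λ j j<h → f≡g j (m≤n⇒m≤1+n j<h)))

  sumOver-seqs-suc : ∀ bd l (f : List Step → ℕ) →
    sumOver (seqs bd (suc l)) f ≡
    sumOver (seqs bd l) (λ s → f (U ∷ s)) + sumBelow bd (λ k → sumOver (seqs bd l) (λ s → f (D k ∷ s)))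
  sumOver-seqs-suc bd l f = begin
    sumOver (concatMap (λ s → map (_∷ s) steps) (seqs bd l)) f
      ≡⟨ sumOver-concatMap _ (seqs bd l) f ⟩
    sumOver (seqs bd l) (λ s → sumOver (map (_∷ s) steps) f)
      ≡⟨ sumOver-cong (seqs bd l) (λ s → trans (sumOver-map (_∷ s) steps f)
           (cong (f (U ∷ s) +_) (trans (sumOver-map D (upTo bd) _) (sumOver-applyUpTo (λ k → k) bd _)))) ⟩
    sumOver (seqs bd l) (λ s → f (U ∷ s) + sumBelow bd (λ k → f (D k ∷ s)))
      ≡⟨ sumOver-+ (seqs bd l) _ _ ⟩
    sumOver (seqs bd l) (λ s → f (U ∷ s)) + sumOver (seqs bd l) (λ s → sumBelow bd (λ k → f (D k ∷ s)))
      ≡⟨ cong (sumOver (seqs bd l) (λ s → f (U ∷ s)) +_) (sumOver-sumBelow (seqs bd l) bd _) ⟩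
    sumOver (seqs bd l) (λ s → f (U ∷ s)) + sumBelow bd (λ k → sumOver (seqs bd l) (λ s → f (D k ∷ s))) ∎
    where
    steps : List Step
    steps = U ∷ map D (upTo bd)

  -- A step sequence s is read from height h with a
  -- pending up-run of length a; it is accepted for m if it ends on the
  -- x-axis without going below it and produces m up-runs of length 1.

  onAxis : Maybe ℕ → Bool
  onAxis (just zero) = true
  onAxis _           = false

  unitRuns : ℕ → List Step → ℕ
  unitRuns a s = length (filterᵇ (λ r → r ≡ᵇ 1) (upRunsFrom a s))

  accepted : ℕ → ℕ → ℕ → List Step → Bool
  accepted h a m s = onAxis (walk h s) ∧ (unitRuns a s ≡ᵇ m)

  #accepted : ℕ → ℕ → ℕ → ℕ → ℕ → ℕ
  #accepted bd l h a m = sumOver (seqs bd l) (λ s → indicator (accepted h a m s))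

  -- (shiftIf b f) m: the coefficient of t^m in t·F if b holds and in F
  -- otherwise, where F = Σ f m t^m
  shiftIf : Bool → (ℕ → ℕ) → ℕ → ℕ
  shiftIf false f m       = f m
  shiftIf true  f zero    = 0
  shiftIf true  f (suc m) = f m

  shiftIf-cong : ∀ b m {f g : ℕ → ℕ} → (∀ k → f k ≡ g k) → shiftIf b f m ≡ shiftIf b g m
  shiftIf-cong false m       f≡g = f≡g m
  shiftIf-cong true  zero    f≡g = refl
  shiftIf-cong true  (suc m) f≡g = f≡g m

  unitRun : ℕ → ℕ
  unitRun a = if a ≡ᵇ 1 then 1 else 0

  -- An up-step extends the
  -- run; a down-step to height j < h closes it, contributing a factor t if
  -- it had length 1.
  paths : ℕ → ℕ → ℕ → ℕ → ℕ
  paths a h zero    m = indicator ((h ≡ᵇ 0) ∧ (unitRun a ≡ᵇ m))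
  paths a h (suc l) m = paths (suc a) (suc h) l m + sumLess h (λ j → shiftIf (a ≡ᵇ 1) (paths 0 j l) m)

  accepted-U : ∀ h a m s → accepted h a m (U ∷ s) ≡ accepted (suc h) (suc a) m s
  accepted-U h zero    m s = refl
  accepted-U h (suc a) m s = refl

  #accepted-D : ∀ (xs : List (List Step)) h a m k →
    sumOver xs (λ s → indicator (accepted h a m (D k ∷ s))) ≡
    (if suc k ≤ᵇ h then shiftIf (a ≡ᵇ 1) (λ m′ → sumOver xs (λ s → indicator (accepted (h ∸ suc k) 0 m′ s))) m
                   else 0)
  #accepted-D xs h a m k with suc k ≤ᵇ h
  ... | false = sumOver-zero xs (λ _ → refl)
  #accepted-D xs h zero                m       k | true = refl
  #accepted-D xs h (suc zero)          zero    k | true =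
    sumOver-zero xs (λ s → cong indicator (∧-zeroʳ (onAxis (walk (h ∸ suc k) s))))
  #accepted-D xs h (suc zero)          (suc m) k | true = refl
  #accepted-D xs h (suc (suc a))       m       k | true = refl

  -- All down-steps from height h together (the size bound bd ≥ h allows
  -- every down-step that stays above the axis).
  #accepted-down : ∀ (xs : List (List Step)) bd h a m → h ≤ bd →
    sumBelow bd (λ k → sumOver xs (λ s → indicator (accepted h a m (D k ∷ s)))) ≡
    sumLess h (λ j → shiftIf (a ≡ᵇ 1) (λ m′ → sumOver xs (λ s → indicator (accepted j 0 m′ s))) m)
  #accepted-down xs bd h a m h≤bd = begin
    sumBelow bd (λ k → sumOver xs (λ s → indicator (accepted h a m (D k ∷ s))))
      ≡⟨ sumBelow-cong bd (#accepted-D xs h a m) ⟩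
    sumBelow bd (λ k → if suc k ≤ᵇ h then F (h ∸ suc k) else 0)
      ≡⟨ sumBelow-truncate bd h (λ k → F (h ∸ suc k)) h≤bd ⟩
    sumBelow h (λ k → F (h ∸ suc k))
      ≡⟨ sumBelow-targets h F ⟩
    sumLess h F ∎
    where
    F : ℕ → ℕ
    F j = shiftIf (a ≡ᵇ 1) (λ m′ → sumOver xs (λ s → indicator (accepted j 0 m′ s))) m

  -- The automaton count satisfies the recurrence of paths, as long as the
  -- size bound bd does not cut off any down-step (h + l ≤ bd).
  #accepted≡paths : ∀ bd l h a m → h + l ≤ bd → #accepted bd l h a m ≡ paths a h l m
  #accepted≡paths bd zero    h a m _ = base h a
    where
    base : ∀ h a → indicator (accepted h a m []) + 0 ≡ paths a h zero m
    base zero    zero          with 0 ≡ᵇ m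
    ... | true  = refl
    ... | false = refl
    base zero    (suc zero)    with 1 ≡ᵇ m
    ... | true  = refl
    ... | false = refl
    base zero    (suc (suc a)) with 0 ≡ᵇ m
    ... | true  = refl
    ... | false = refl
    base (suc h) a = refl
  #accepted≡paths bd (suc l) h a m h+l<bd = begin
    #accepted bd (suc l) h a m
      ≡⟨ sumOver-seqs-suc bd l _ ⟩
    sumOver xs (λ s → indicator (accepted h a m (U ∷ s)))
      + sumBelow bd (λ k → sumOver xs (λ s → indicator (accepted h a m (D k ∷ s))))
      ≡⟨ cong₂ _+_ (sumOver-cong xs (λ s → cong indicator (accepted-U h a m s)))
                   (#accepted-down xs bd h a m (≤-trans (m≤m+n h (suc l)) h+l<bd)) ⟩
    #accepted bd l (suc h) (suc a) m
      + sumLess h (λ j → shiftIf (a ≡ᵇ 1) (λ m′ → #accepted bd l j 0 m′) m)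
      ≡⟨ cong₂ _+_ (#accepted≡paths bd l (suc h) (suc a) m (subst (_≤ bd) (+-suc h l) h+l<bd))
                   (sumLess-cong h (λ j j<h → shiftIf-cong (a ≡ᵇ 1) m (λ m′ →
                      #accepted≡paths bd l j 0 m′ (j+l≤bd j j<h)))) ⟩
    paths a h (suc l) m ∎
    where
    xs = seqs bd l
    j+l≤bd : ∀ j → j < h → j + l ≤ bd
    j+l≤bd j j<h = ≤-trans (+-monoˡ-≤ l (<⇒≤ j<h)) (≤-trans (+-monoʳ-≤ h (n≤1+n l)) h+l<bd)

  endsAtZero-onAxis : ∀ s → endsAtZero s ≡ onAxis (walk 0 s)
  endsAtZero-onAxis s with walk 0 s
  ... | just zero    = refl
  ... | just (suc _) = refl
  ... | nothing      = refl

  b≡paths : ∀ n m → b n m ≡ paths 0 0 n m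
  b≡paths n m = begin
    b n m
      ≡⟨ length-filter _ (seqs n n) ⟩
    sumOver (seqs n n) (λ s → indicator (endsAtZero s ∧ (runs1 s ≡ᵇ m)))
      ≡⟨ sumOver-cong (seqs n n) (λ s → cong (λ e → indicator (e ∧ (runs1 s ≡ᵇ m))) (endsAtZero-onAxis s)) ⟩
    #accepted n n 0 0 m
      ≡⟨ #accepted≡paths n n 0 0 m ≤-refl ⟩
    paths 0 0 n m ∎

  -- Only whether a run has length 0, 1 or ≥ 2 matters.
  paths-long-run : ∀ a h l m → paths (suc (suc a)) h l m ≡ paths 2 h l m
  paths-long-run a h zero    m = refl
  paths-long-run a h (suc l) m =
    cong (_+ sumLess h (λ j → paths 0 j l m))
         (trans (paths-long-run (suc a) (suc h) l m) (sym (paths-long-run 1 (suc h) l m)))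

  by-small-cases : (Q : ℕ → Set) → Q 0 → Q 1 → Q 2 → Q 3 → Q 4 → Q 5 → Q 6 → Q 7 →
                   (∀ k → Q (8 + k)) → ∀ m → Q m
  by-small-cases Q q₀ q₁ q₂ q₃ q₄ q₅ q₆ q₇ q₈₊ 0 = q₀
  by-small-cases Q q₀ q₁ q₂ q₃ q₄ q₅ q₆ q₇ q₈₊ 1 = q₁
  by-small-cases Q q₀ q₁ q₂ q₃ q₄ q₅ q₆ q₇ q₈₊ 2 = q₂
  by-small-cases Q q₀ q₁ q₂ q₃ q₄ q₅ q₆ q₇ q₈₊ 3 = q₃
  by-small-cases Q q₀ q₁ q₂ q₃ q₄ q₅ q₆ q₇ q₈₊ 4 = q₄
  by-small-cases Q q₀ q₁ q₂ q₃ q₄ q₅ q₆ q₇ q₈₊ 5 = q₅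
  by-small-cases Q q₀ q₁ q₂ q₃ q₄ q₅ q₆ q₇ q₈₊ 6 = q₆
  by-small-cases Q q₀ q₁ q₂ q₃ q₄ q₅ q₆ q₇ q₈₊ 7 = q₇
  by-small-cases Q q₀ q₁ q₂ q₃ q₄ q₅ q₆ q₇ q₈₊ (suc (suc (suc (suc (suc (suc (suc (suc k)))))))) = q₈₊ k

  paths-table : ∀ n → n ≤ 7 → ∀ m → paths 0 0 n m ≡ table n m
  paths-table 0 _ = by-small-cases _ refl refl refl refl refl refl refl refl (λ _ → refl)
  paths-table 1 _ = by-small-cases _ refl refl refl refl refl refl refl refl (λ _ → refl)
  paths-table 2 _ = by-small-cases _ refl refl refl refl refl refl refl refl (λ _ → refl)
  paths-table 3 _ = by-small-cases _ refl refl refl refl refl refl refl refl (λ _ → refl)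
  paths-table 4 _ = by-small-cases _ refl refl refl refl refl refl refl refl (λ _ → refl)
  paths-table 5 _ = by-small-cases _ refl refl refl refl refl refl refl refl (λ _ → refl)
  paths-table 6 _ = by-small-cases _ refl refl refl refl refl refl refl refl (λ _ → refl)
  paths-table 7 _ = by-small-cases _ refl refl refl refl refl refl refl refl (λ _ → refl)
  paths-table (suc (suc (suc (suc (suc (suc (suc (suc n)))))))) (s≤s (s≤s (s≤s (s≤s (s≤s (s≤s (s≤s ())))))))

open Counting

open import Data.Nat using (ℕ; zero; suc; _≤_; _<_; _≡ᵇ_; s≤s)
open import Data.Nat.Properties using (≤-refl; ≤-<-trans; m∸n≤m)
import Data.Nat as ℕ
open import Data.Bool using (true; false; if_then_else_)
open import Data.Bool.Properties using (∧-zeroʳ)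
open import Data.Integer as ℤ using (ℤ; +_)
import Data.Integer.Properties as ℤP
open import Data.Maybe using (Maybe; just; nothing)
open import Data.Product using (Σ; _×_; _,_; proj₁)
open import Relation.Nullary using (yes; no)
open import Algebra.Solver.Ring.AlmostCommutativeRing
  using (fromCommutativeRing; _-Raw-AlmostCommutative⟶_)
import Relation.Binary.PropositionalEquality as P
open P using (_≡_; cong; cong₂)

-- ℤ[[t]], and the ring ℤ[[t]][[z]] of bivariate series; its carrier
-- ℕ → ℕ → ℤ is FPS.
module T = PowerSeries ℤP.+-*-commutativeRing
module Z = PowerSeries T.seriesRing

open CommutativeRing Z.seriesRing
  using (_≈_; _+_; _*_; -_; 0#; 1#; refl; sym; trans; +-cong; +-congˡ; +-congʳ; *-cong; *-congˡ;
         +-identityˡ; +-identityʳ; +-comm; *-identityˡ; zeroʳ; distribˡ; -‿cong; -‿inverseʳ)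

z t : FPS
z = Z.𝕏
t = Z.const T.𝕏

int : ℤ → FPS
int k = Z.const (T.const k)

G : ℕ → ℕ → FPS
G a h l m = + paths a h l m

G₀ : ℕ → ℕ → FPS
G₀ a h = Z.const (G a h 0)

-- Dsum h = G 0 (h − 1) + ⋯ + G 0 0: after a down-step from height h
Dsum : ℕ → FPS
Dsum zero    = 0#
Dsum (suc h) = G 0 h + Dsum h

-- closing a run of length a costs t if a = 1
weight : ℕ → FPS
weight a = if a ≡ᵇ 1 then t else 1#

Dsum-coeff : ∀ h l m → Dsum h l m ≡ + sumLess h (λ j → paths 0 j l m)
Dsum-coeff zero    l m = P.refl
Dsum-coeff (suc h) l m = cong (λ y → (+ paths 0 h l m) ℤ.+ y) (Dsum-coeff h l m)

weight-coeff : ∀ a F (f : ℕ → ℕ) l → (∀ m → F l m ≡ + f m) →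
               ∀ m → (weight a * F) l m ≡ + shiftIf (a ≡ᵇ 1) f m
weight-coeff zero          F f l F≡f m       = P.trans (Z.⊠-identityˡ F l m) (F≡f m)
weight-coeff (suc (suc a)) F f l F≡f m       = P.trans (Z.⊠-identityˡ F l m) (F≡f m)
weight-coeff (suc zero)    F f l F≡f zero    = P.trans (Z.const-⊠ T.𝕏 F l zero) (T.𝕏-⊠-zero (F l))
weight-coeff (suc zero)    F f l F≡f (suc m) =
  P.trans (Z.const-⊠ T.𝕏 F l (suc m)) (P.trans (T.𝕏-⊠-suc (F l) m) (F≡f m))

sumLess-shiftIf : ∀ h b (f : ℕ → ℕ → ℕ) m →
  sumLess h (λ j → shiftIf b (f j) m) ≡ shiftIf b (λ m′ → sumLess h (λ j → f j m′)) m
sumLess-shiftIf h       false f m       = P.refl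
sumLess-shiftIf h       true  f (suc m) = P.refl
sumLess-shiftIf zero    true  f zero    = P.refl
sumLess-shiftIf (suc h) true  f zero    = sumLess-shiftIf h true f zero

G-recurrence : ∀ a h → G a h ≈ G₀ a h + z * (G (suc a) (suc h) + weight a * Dsum h)
G-recurrence a h zero    m = P.sym (P.trans (cong (λ y → G a h 0 m ℤ.+ y) (Z.𝕏-⊠-zero X m)) (ℤP.+-identityʳ _))
  where X = G (suc a) (suc h) + weight a * Dsum h
G-recurrence a h (suc l) m = P.sym (begin
  + 0 ℤ.+ (z * X) (suc l) m
    ≡⟨ P.trans (ℤP.+-identityˡ _) (Z.𝕏-⊠-suc X l m) ⟩
  + paths (suc a) (suc h) l m ℤ.+ (weight a * Dsum h) l m
    ≡⟨ cong (λ y → (+ paths (suc a) (suc h) l m) ℤ.+ y) (weight-coeff a (Dsum h) _ l (Dsum-coeff h l) m) ⟩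
  + paths (suc a) (suc h) l m ℤ.+ + shiftIf (a ≡ᵇ 1) (λ m′ → sumLess h (λ j → paths 0 j l m′)) m
    ≡⟨ cong (λ n → + paths (suc a) (suc h) l m ℤ.+ + n) (P.sym (sumLess-shiftIf h (a ≡ᵇ 1) (λ j → paths 0 j l) m)) ⟩
  + paths a h (suc l) m ∎)
  where
  open P.≡-Reasoning
  X = G (suc a) (suc h) + weight a * Dsum h

-- Above the axis there is no empty continuation.
G-recurrence-suc : ∀ a h → G a (suc h) ≈ z * (G (suc a) (suc (suc h)) + weight a * Dsum (suc h))
G-recurrence-suc a h = trans (G-recurrence a (suc h)) (trans (+-congʳ {z * (G (suc a) (suc (suc h)) + weight a * Dsum (suc h))} G₀≈0) (+-identityˡ _))
  where
  G₀≈0 : G₀ a (suc h) ≈ 0#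
  G₀≈0 zero    m = P.refl
  G₀≈0 (suc l) m = P.refl

-- Integer constants form a ring homomorphism ℤ → ℤ[[t]][[z]]; this lets
-- the ring solver normalise polynomial identities with integer
-- coefficients in the series ring.
int-+ : ∀ j k → int (j ℤ.+ k) ≈ int j + int k
int-+ j k zero    zero    = P.refl
int-+ j k zero    (suc m) = P.refl
int-+ j k (suc l) m       = P.refl

int-* : ∀ j k → int (j ℤ.* k) ≈ int j * int k
int-* j k l m = P.sym (P.trans (Z.const-⊠ (T.const j) (int k) l m) (coeff l m))
  where
  coeff : ∀ l m → (T.const j T.⊠ int k l) m ≡ int (j ℤ.* k) l m
  coeff zero    m       = P.trans (T.const-⊠ j (T.const k) m) (constant m)
    where
    constant : ∀ m → j ℤ.* T.const k m ≡ T.const (j ℤ.* k) m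
    constant zero    = P.refl
    constant (suc m) = ℤP.*-zeroʳ j
  coeff (suc l) m = P.trans (T.const-⊠ j (λ _ → + 0) m) (ℤP.*-zeroʳ j)

int-neg : ∀ k → int (ℤ.- k) ≈ - int k
int-neg k zero    zero    = P.refl
int-neg k zero    (suc m) = P.refl
int-neg k (suc l) m       = P.refl

int-0 : int (+ 0) ≈ 0#
int-0 zero    zero    = P.refl
int-0 zero    (suc m) = P.refl
int-0 (suc l) m       = P.refl

int-1 : int (+ 1) ≈ 1#
int-1 zero    zero    = P.refl
int-1 zero    (suc m) = P.refl
int-1 (suc l) m       = P.refl

int-homomorphism : CommutativeRing.rawRing ℤP.+-*-commutativeRing
                   -Raw-AlmostCommutative⟶ fromCommutativeRing Z.seriesRing
int-homomorphism = record
  { ⟦_⟧ = int ; +-homo = int-+ ; *-homo = int-* ; -‿homo = int-neg ; 0-homo = int-0 ; 1-homo = int-1 }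

int-≟ : ∀ j k → Maybe (int j ≈ int k)
int-≟ j k with j ℤ.≟ k
... | yes P.refl = just refl
... | no  _      = nothing

open import Algebra.Solver.Ring (CommutativeRing.rawRing ℤP.+-*-commutativeRing)
  (fromCommutativeRing Z.seriesRing) int-homomorphism int-≟
  using (Polynomial; solve; _:=_; _:+_; _:*_; _:-_; :-_; con)

record _≃[_]_ (F : FPS) (l : ℕ) (H : FPS) : Set where
  constructor agree
  field below : ∀ i → i < l → F i T.≐ H i
open _≃[_]_

infix 4 _≃[_]_

≈⇒≃ : ∀ {l F H} → F ≈ H → F ≃[ l ] H
≈⇒≃ F≈H = agree (λ i _ → F≈H i)

≃-sym : ∀ {l F H} → F ≃[ l ] H → H ≃[ l ] F
≃-sym F≃H = agree (λ i i<l m → P.sym (below F≃H i i<l m))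

≃-trans : ∀ {l F H K} → F ≃[ l ] H → H ≃[ l ] K → F ≃[ l ] K
≃-trans F≃H H≃K = agree (λ i i<l m → P.trans (below F≃H i i<l m) (below H≃K i i<l m))

≃-by : ∀ {l F F′ H H′} → F ≈ F′ → F′ ≃[ l ] H′ → H′ ≈ H → F ≃[ l ] H
≃-by F≈F′ F′≃H′ H′≈H = ≃-trans (≈⇒≃ F≈F′) (≃-trans F′≃H′ (≈⇒≃ H′≈H))

≃-+ : ∀ {l F F′ H H′} → F ≃[ l ] H → F′ ≃[ l ] H′ → F + F′ ≃[ l ] H + H′
≃-+ F≃H F′≃H′ = agree (λ i i<l m → cong₂ ℤ._+_ (below F≃H i i<l m) (below F′≃H′ i i<l m))

-- The z^i-coefficient of K·F only involves F below z^{i+1}.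
≃-*ˡ : ∀ {l} K {F H} → F ≃[ l ] H → K * F ≃[ l ] K * H
≃-*ˡ K F≃H = agree (λ i i<l → Z.Σ-cong i (λ a _ →
  T.⊠-cong {K a} (λ _ → P.refl) (below F≃H (i ℕ.∸ a) (≤-<-trans (m∸n≤m i a) i<l))))

≃-z : ∀ {l F H} → F ≃[ l ] H → z * F ≃[ suc l ] z * H
≃-z {F = F} {H} F≃H = agree coeff
  where
  coeff : ∀ i → i < suc _ → (z * F) i T.≐ (z * H) i
  coeff zero    _         m = P.trans (Z.𝕏-⊠-zero F m) (P.sym (Z.𝕏-⊠-zero H m))
  coeff (suc i) (s≤s i<l) m = P.trans (Z.𝕏-⊠-suc F i m) (P.trans (below F≃H i i<l m) (P.sym (Z.𝕏-⊠-suc H i m)))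

B : FPS
B = G 0 0

-- X = (1 + z) B: the factor by which the generating function drops when
-- the starting height is raised by one (above height 1).
X : FPS
X = (int (+ 1) + z) * B

z-X-commute : ∀ (g d w : FPS) → z * (X * g + w * (X * d)) ≈ X * (z * (g + w * d))
z-X-commute g d w = solve 5 (λ Z X′ G′ D′ W → Z :* (X′ :* G′ :+ W :* (X′ :* D′)) := X′ :* (Z :* (G′ :+ W :* D′)))
                            refl z X g d w

B-equation : B ≈ int (+ 1) + z * G 1 1
B-equation = trans (G-recurrence 0 0) (+-cong (trans G₀≈1 (sym int-1)) (*-congˡ {z} empty-D))
  where
  G₀≈1 : G₀ 0 0 ≈ 1#
  G₀≈1 zero    zero    = P.refl
  G₀≈1 zero    (suc m) = P.refl
  G₀≈1 (suc l) m       = P.refl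
  empty-D : G 1 1 + weight 0 * Dsum 0 ≈ G 1 1
  empty-D = trans (+-congˡ {G 1 1} (zeroʳ 1#)) (+-identityʳ (G 1 1))

-- The statements proved together by induction on the order l:
-- G a (h+2) = X · G a (h+1),  X · B = B + G 0 1,  Dsum (h+2) = X · Dsum (h+1).
Factor FactorB FactorDsum : ℕ → Set
Factor     l = ∀ h a → G a (suc (suc h)) ≃[ l ] X * G a (suc h)
FactorB    l = X * B ≃[ l ] B + G 0 1
FactorDsum l = ∀ h → Dsum (suc (suc h)) ≃[ l ] X * Dsum (suc h)

-- Dsum (h+2) = G 0 (h+1) + Dsum (h+1) splits into terms already factored.
factorDsum : ∀ {l} → Factor l → FactorB l → FactorDsum l
factorDsum fac facB zero = ≃-by D₂≈ (≃-sym facB) (*-congˡ {X} (sym (+-identityʳ B)))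
  where
  D₂≈ : Dsum 2 ≈ B + G 0 1
  D₂≈ = trans (+-congˡ {G 0 1} (+-identityʳ B)) (+-comm (G 0 1) B)
factorDsum fac facB (suc h) =
  ≃-by refl (≃-+ (fac h 0) (factorDsum fac facB h)) (sym (distribˡ X (G 0 (suc h)) (Dsum (suc h))))

-- Through the recurrence, order l of both factorisations gives order
-- l + 1 of the first.
factor-step : ∀ {l} → Factor l → FactorDsum l → Factor (suc l)
factor-step fac facD h a = ≃-by (G-recurrence-suc a (suc h))
  (≃-z (≃-+ (fac (suc h) (suc a)) (≃-*ˡ (weight a) (facD h))))
  (trans (z-X-commute (G (suc a) (suc (suc h))) (Dsum (suc h)) (weight a)) (*-congˡ {X} (sym (G-recurrence-suc a h))))

-- X·B = B + z·(X·G 1 1) + z·B, and z·(X·G 1 1) agrees with z·G 1 2 one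
-- order further than X·G 1 1 with G 1 2.
factorB-step : ∀ {l} → Factor l → FactorB (suc l)
factorB-step fac = ≃-by XB≈ (≃-+ (≃-+ (≈⇒≃ {F = B} refl) (≃-z (≃-sym (fac 0 1)))) (≈⇒≃ {F = z * B} refl)) expand
  where
  zG11≈ : B + - int (+ 1) ≈ z * G 1 1
  zG11≈ = trans (+-congʳ { - int (+ 1)} B-equation) (solve 1 (λ Y → (con (+ 1) :+ Y) :- con (+ 1) := Y) refl (z * G 1 1))
  XB≈ : X * B ≈ (B + z * (X * G 1 1)) + z * B
  XB≈ = trans (solve 2 (λ Z B′ → (con (+ 1) :+ Z) :* B′ :* B′ := (B′ :+ (con (+ 1) :+ Z) :* B′ :* (B′ :- con (+ 1))) :+ Z :* B′) refl z B)
              (+-congʳ {z * B} (+-congˡ {B} (trans (*-congˡ {X} zG11≈) (solve 3 (λ X′ Z G′ → X′ :* (Z :* G′) := Z :* (X′ :* G′)) refl X z (G 1 1)))))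
  G01≈ : z * (G 1 2 + B) ≈ G 0 1
  G01≈ = trans (*-congˡ {z} (+-congˡ {G 1 2} (sym (trans (*-identityˡ _) (+-identityʳ B))))) (sym (G-recurrence-suc 0 0))
  expand : (B + z * G 1 2) + z * B ≈ B + G 0 1
  expand = trans (solve 3 (λ B′ Z G′ → (B′ :+ Z :* G′) :+ Z :* B′ := B′ :+ Z :* (G′ :+ B′)) refl B z (G 1 2))
                 (+-congˡ {B} G01≈)

factors : ∀ l → Factor l × FactorB l
factors zero    = (λ h a → agree (λ i ())) , agree (λ i ())
factors (suc l) with factors l
... | fac , facB = factor-step fac (factorDsum fac facB) , factorB-step fac

-- The z^i-coefficients agree at order i + 1, so the factorisation is exact.
factorisation : ∀ h a → G a (suc (suc h)) ≈ X * G a (suc h)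
factorisation h a i = below (proj₁ (factors (suc i)) h a) i ≤-refl

-- The closed system for B, C₁ and C₂, the generating functions of the
-- continuations from height 1 with a pending up-run of length 1, resp. 2.
C₁ C₂ : FPS
C₁ = G 1 1
C₂ = G 2 1

-- From height 1 the only down-step leads to the origin.
Dsum1≈B : Dsum 1 ≈ B
Dsum1≈B = +-identityʳ B

C₁-equation : C₁ ≈ z * (X * C₂ + t * B)
C₁-equation = trans (G-recurrence-suc 1 0) (*-congˡ {z} (+-cong (factorisation 0 2) (*-congˡ {t} Dsum1≈B)))

C₂-equation : C₂ ≈ z * (X * C₂ + B)
C₂-equation = trans (G-recurrence-suc 2 0)
  (*-congˡ {z} (+-cong (trans long-run (factorisation 0 2)) (trans (*-identityˡ _) Dsum1≈B)))
  where
  long-run : G 3 2 ≈ G 2 2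
  long-run l m = cong +_ (paths-long-run 1 2 l m)

infixl 6 _-_
_-_ : FPS → FPS → FPS
F - H = F + - H

-- Polynomials in z and t with integer coefficients, as expressions that
-- can be read coefficientwise (as in the statement), as elements of the
-- series ring, and as input for the ring solver.
infixl 6 _⊕ᵖ_ _⊖ᵖ_
infixl 7 _⊗ᵖ_
data Poly : Set where
  mono           : ℤ → ℕ → ℕ → Poly
  _⊕ᵖ_ _⊖ᵖ_ _⊗ᵖ_ : Poly → Poly → Poly

asFPS : Poly → FPS
asFPS (mono k a e) = mon k a e
asFPS (p ⊕ᵖ q)     = asFPS p ⊕ asFPS q
asFPS (p ⊖ᵖ q)     = asFPS p ⊖ asFPS q
asFPS (p ⊗ᵖ q)     = asFPS p ⊗ asFPS q

monomial : ℤ → ℕ → ℕ → FPS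
monomial k (suc a) e       = z * monomial k a e
monomial k zero    (suc e) = t * monomial k zero e
monomial k zero    zero    = int k

asSeries : Poly → FPS
asSeries (mono k a e) = monomial k a e
asSeries (p ⊕ᵖ q)     = asSeries p + asSeries q
asSeries (p ⊖ᵖ q)     = asSeries p - asSeries q
asSeries (p ⊗ᵖ q)     = asSeries p * asSeries q

asPolynomial : ∀ {n} → Polynomial n → Polynomial n → Poly → Polynomial n
asPolynomial Z T (mono k (suc a) e)       = Z :* asPolynomial Z T (mono k a e)
asPolynomial Z T (mono k zero    (suc e)) = T :* asPolynomial Z T (mono k zero e)
asPolynomial Z T (mono k zero    zero)    = con k
asPolynomial Z T (p ⊕ᵖ q)                 = asPolynomial Z T p :+ asPolynomial Z T q
asPolynomial Z T (p ⊖ᵖ q)                 = asPolynomial Z T p :- asPolynomial Z T q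
asPolynomial Z T (p ⊗ᵖ q)                 = asPolynomial Z T p :* asPolynomial Z T q

mon≈monomial : ∀ k a e → mon k a e ≈ monomial k a e
mon≈monomial k (suc a) e zero    j = P.sym (Z.𝕏-⊠-zero (monomial k a e) j)
mon≈monomial k (suc a) e (suc i) j = P.trans (mon≈monomial k a e i j) (P.sym (Z.𝕏-⊠-suc (monomial k a e) i j))
mon≈monomial k zero (suc e) i zero    =
  P.trans (cong (if_then k else + 0) (∧-zeroʳ (i ≡ᵇ 0)))
          (P.sym (P.trans (Z.const-⊠ T.𝕏 (monomial k zero e) i zero) (T.𝕏-⊠-zero (monomial k zero e i))))
mon≈monomial k zero (suc e) i (suc j) =
  P.trans (mon≈monomial k zero e i j)
          (P.sym (P.trans (Z.const-⊠ T.𝕏 (monomial k zero e) i (suc j)) (T.𝕏-⊠-suc (monomial k zero e i) j)))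
mon≈monomial k zero zero zero    zero    = P.refl
mon≈monomial k zero zero zero    (suc j) = P.refl
mon≈monomial k zero zero (suc i) j       = P.refl

sumTo≡Σ≤ : ∀ n f → sumTo n f ≡ T.Σ≤ n f
sumTo≡Σ≤ zero    f = P.refl
sumTo≡Σ≤ (suc n) f = cong (ℤ._+ f (suc n)) (sumTo≡Σ≤ n f)

Σ≤-coeff : ∀ n (φ : ℕ → T.Series) j → Z.Σ≤ n φ j ≡ sumTo n (λ a → φ a j)
Σ≤-coeff zero    φ j = P.refl
Σ≤-coeff (suc n) φ j = cong (ℤ._+ φ (suc n) j) (Σ≤-coeff n φ j)

⊗≈* : ∀ F H → F ⊗ H ≈ F * H
⊗≈* F H i j = P.trans (sumTo-cong i (λ a → sumTo≡Σ≤ j _)) (P.sym (Σ≤-coeff i _ j))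
  where
  sumTo-cong : ∀ n {f g : ℕ → ℤ} → (∀ a → f a ≡ g a) → sumTo n f ≡ sumTo n g
  sumTo-cong zero    f≡g = f≡g 0
  sumTo-cong (suc n) f≡g = cong₂ ℤ._+_ (sumTo-cong n f≡g) (f≡g (suc n))

asFPS≈asSeries : ∀ p → asFPS p ≈ asSeries p
asFPS≈asSeries (mono k a e) = mon≈monomial k a e
asFPS≈asSeries (p ⊕ᵖ q)     = +-cong (asFPS≈asSeries p) (asFPS≈asSeries q)
asFPS≈asSeries (p ⊖ᵖ q)     = +-cong (asFPS≈asSeries p) (-‿cong (asFPS≈asSeries q))
asFPS≈asSeries (p ⊗ᵖ q)     = trans (⊗≈* (asFPS p) (asFPS q)) (*-cong (asFPS≈asSeries p) (asFPS≈asSeries q))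

numᵖ denᵖ radᵖ : Poly
numᵖ = mono (+ 1) 0 0 ⊕ᵖ mono (+ 1) 1 0 ⊕ᵖ mono (+ 1) 2 0 ⊖ᵖ mono (+ 1) 2 1
denᵖ = mono (+ 2) 1 0 ⊗ᵖ (mono (+ 1) 0 0 ⊕ᵖ mono (+ 1) 1 0)
       ⊗ᵖ (mono (+ 1) 0 0 ⊕ᵖ mono (+ 1) 2 0 ⊖ᵖ mono (+ 1) 2 1)
radᵖ = mono (+ 1) 4 2 ⊕ᵖ mono (+ 2) 3 1 ⊖ᵖ mono (+ 2) 2 1 ⊕ᵖ mono (+ 2) 4 1
       ⊖ᵖ mono (+ 1) 2 0 ⊖ᵖ mono (+ 2) 1 0 ⊖ᵖ mono (+ 2) 3 0 ⊕ᵖ mono (+ 1) 0 0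
       ⊖ᵖ mono (+ 3) 4 0

-- The multiplier of the relations in the elimination identity.
K : FPS
K = int (ℤ.- + 4) * z * (int (+ 1) + z) * (int (+ 1) + z * z - t * z * z)

elimination : ∀ B′ C₁′ C₂′ → let X′ = (int (+ 1) + z) * B′ in
  (asSeries numᵖ - asSeries denᵖ * B′) * (asSeries numᵖ - asSeries denᵖ * B′) ≈
  asSeries radᵖ + K * ((int (+ 1) - z * X′) * ((B′ - (int (+ 1) + z * C₁′)) + z * (C₁′ - z * (X′ * C₂′ + t * B′)))
                        + z * z * X′ * (C₂′ - z * (X′ * C₂′ + B′)))
elimination = solve 5 (λ Z T B′ C₁′ C₂′ →
  let X′  = (con (+ 1) :+ Z) :* B′
      one = con (+ 1)
      S′  = asPolynomial Z T numᵖ :- asPolynomial Z T denᵖ :* B′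
      K′  = con (ℤ.- + 4) :* Z :* (one :+ Z) :* (one :+ Z :* Z :- T :* Z :* Z)
  in S′ :* S′ := asPolynomial Z T radᵖ
                  :+ K′ :* ((one :- Z :* X′) :* ((B′ :- (one :+ Z :* C₁′)) :+ Z :* (C₁′ :- Z :* (X′ :* C₂′ :+ T :* B′)))
                           :+ Z :* Z :* X′ :* (C₂′ :- Z :* (X′ :* C₂′ :+ B′))))
  refl z t

difference-vanishes : ∀ {F H} → F ≈ H → F - H ≈ 0#
difference-vanishes {H = H} F≈H = trans (+-congʳ F≈H) (-‿inverseʳ H)

combination-vanishes : ∀ a b c {d e f} → d ≈ 0# → e ≈ 0# → f ≈ 0# → a * (d + b * e) + c * f ≈ 0#
combination-vanishes a b c {d} {e} {f} d≈0 e≈0 f≈0 = begin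
  a * (d + b * e) + c * f ≈⟨ +-cong (*-congˡ {a} (+-cong d≈0 (trans (*-congˡ {b} e≈0) (zeroʳ b)))) (trans (*-congˡ {c} f≈0) (zeroʳ c)) ⟩
  a * (0# + 0#) + 0#      ≈⟨ +-identityʳ _ ⟩
  a * (0# + 0#)           ≈⟨ *-congˡ {a} (+-identityʳ 0#) ⟩
  a * 0#                  ≈⟨ zeroʳ a ⟩
  0#                      ∎
  where open import Relation.Binary.Reasoning.Setoid (CommutativeRing.setoid Z.seriesRing)

square-root : (asSeries numᵖ - asSeries denᵖ * B) * (asSeries numᵖ - asSeries denᵖ * B) ≈ asSeries radᵖ
square-root = trans (elimination B C₁ C₂)
  (trans (+-congˡ {asSeries radᵖ} (trans (*-congˡ {K} relations) (zeroʳ K))) (+-identityʳ _))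
  where
  relations = combination-vanishes (int (+ 1) - z * X) z (z * z * X) (difference-vanishes B-equation)
                (difference-vanishes C₁-equation) (difference-vanishes C₂-equation)

-- Den has no constant term in z, hence neither does Den ⊗ F.
⊗-z⁰ : ∀ F H → (∀ j → F 0 j ≡ + 0) → ∀ j → (F ⊗ H) 0 j ≡ + 0
⊗-z⁰ F H F₀≡0 j = P.trans (sumTo≡Σ≤ j _)
  (P.trans (T.Σ-cong′ j (λ c → P.trans (cong (ℤ._* H 0 (j ℕ.∸ c)) (F₀≡0 c)) (ℤP.*-zeroˡ (H 0 (j ℕ.∸ c))))) (T.Σ-0 j))

Den⊗-z⁰ : ∀ F j → (Den ⊗ F) 0 j ≡ + 0
Den⊗-z⁰ F = ⊗-z⁰ (2z ⊗ 1+z ⊗ 1+z²-tz²) F (⊗-z⁰ (2z ⊗ 1+z) 1+z²-tz² (⊗-z⁰ 2z 1+z (λ _ → P.refl)))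
  where
  2z 1+z 1+z²-tz² : FPS
  2z       = mon (+ 2) 1 0
  1+z      = mon (+ 1) 0 0 ⊕ mon (+ 1) 1 0
  1+z²-tz² = mon (+ 1) 0 0 ⊕ mon (+ 1) 2 0 ⊖ mon (+ 1) 2 1

Bser≈B : Bser ≈ B
Bser≈B l m = cong +_ (b≡paths l m)

-- the square root of Rad selected by the statement
S : FPS
S = Num ⊖ Den ⊗ Bser

S≈ : S ≈ asSeries numᵖ - asSeries denᵖ * B
S≈ = +-cong (asFPS≈asSeries numᵖ) (-‿cong (trans (⊗≈* Den Bser) (*-cong (asFPS≈asSeries denᵖ) Bser≈B)))

mainTheorem2 : Σ FPS (λ S → (S ⊗ S ≋ Rad) × zConstOne S × (Den ⊗ Bser ≋ Num ⊖ S))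
               × (∀ n m → n ≤ 7 → b n m ≡ table n m)
mainTheorem2 = (S , S-squared , S-constant , S-solves) , (λ n m n≤7 → P.trans (b≡paths n m) (paths-table n n≤7 m))
  where
  S-squared : S ⊗ S ≋ Rad
  S-squared = trans (⊗≈* S S) (trans (*-cong S≈ S≈) (trans square-root (sym (asFPS≈asSeries radᵖ))))

  S-constant : zConstOne S
  S-constant zero    = cong (λ y → + 1 ℤ.- y) (Den⊗-z⁰ Bser 0)
  S-constant (suc j) = cong (λ y → + 0 ℤ.- y) (Den⊗-z⁰ Bser (suc j))

  S-solves : Den ⊗ Bser ≋ Num ⊖ S
  S-solves = solve 2 (λ N P → P := N :- (N :- P)) refl Num (Den ⊗ Bser)
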